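{- For every transitive tournament $T$ of order $n$, $\gamma^+_{maj}(T)=-n+2\lceil \frac{n+2}{4}\rceil$.
   Context: A tournament is an orientation of a complete graph (each pair of distinct vertices joined by exactly one arc). A digraph $D=(V,A)$ is transitive if $uv\in A$ and $vw\in A$ imply $uw\in A$ for all $u,v,w\in V$. For $u\in V$, $N^+[u]=\{u\}\cup\{v: uv\in A\}$. For $f:V\to\{ -1,1\}$ and $X\subseteq V$, $f(X)=\sum_{v\in X}f(v)$. A majority out-dominating function (MODF) of $D$ is a function $f:V\to\{ -1,1\}$ with $|\{v\in V: f(N^+[v])\geq1\}|\geq |V|/2$; its weight is $w(f)=f(V)$. $\gamma^+_{maj}(D)$ is the minimum weight of a MODF of $D$. -}

module Defs where

open import Data.Bool using (Bool; true; false; if_then_else_)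
open import Data.Nat as ℕ using (ℕ; zero; suc; _/_)
open import Data.Fin using (Fin; zero; suc)
open import Data.Integer as ℤ using (ℤ; +_; -_; _≤_)
open import Data.Integer.Properties using (_≤?_)
open import Data.Product using (_×_; Σ; _,_)
open import Data.Sum using (_⊎_)
open import Relation.Nullary using (does; ¬_)
open import Relation.Binary.PropositionalEquality using (_≡_; _≢_)

Digraph : ℕ → Set
Digraph n = Fin n → Fin n → Bool

IsTournament : ∀ {n} → Digraph n → Set
IsTournament {n} A =
  (∀ (u : Fin n) → A u u ≡ false) ×
  (∀ (u v : Fin n) → u ≢ v → (A u v ≡ true × A v u ≡ false) ⊎ (A u v ≡ false × A v u ≡ true))

IsTransitive : ∀ {n} → Digraph n → Set
IsTransitive {n} A = ∀ (u v w : Fin n) → A u v ≡ true → A v w ≡ true → A u w ≡ true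

sumFin : ∀ {n} → (Fin n → ℤ) → ℤ
sumFin {zero}  g = + 0
sumFin {suc n} g = g zero ℤ.+ sumFin (λ i → g (suc i))

countFin : ∀ {n} → (Fin n → Bool) → ℕ
countFin {zero}  p = 0
countFin {suc n} p = (if p zero then 1 else 0) ℕ.+ countFin (λ i → p (suc i))

SignFun : ℕ → Set
SignFun n = Fin n → ℤ

IsSign : ∀ {n} → SignFun n → Set
IsSign f = ∀ i → (f i ≡ + 1) ⊎ (f i ≡ - (+ 1))

fOn : ∀ {n} → SignFun n → (Fin n → Bool) → ℤ
fOn f X = sumFin (λ v → if X v then f v else + 0)

closedOutNbhd : ∀ {n} → Digraph n → Fin n → Fin n → Bool
closedOutNbhd A u v = if does (u Data.Fin.≟ v) then true else A u v

weight : ∀ {n} → SignFun n → ℤ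
weight f = sumFin f

goodCount : ∀ {n} → Digraph n → SignFun n → ℕ
goodCount A f = countFin (λ v → does (+ 1 ≤? fOn f (closedOutNbhd A v)))

-- MODF: |{v : f(N⁺[v]) ≥ 1}| ≥ |V|/2, i.e. 2·count ≥ n
IsMODF : ∀ {n} → Digraph n → SignFun n → Set
IsMODF {n} A f = IsSign f × (n ℕ.≤ 2 ℕ.* goodCount A f)

IsMajOutDomNumber : ∀ {n} → Digraph n → ℤ → Set
IsMajOutDomNumber A k =
  Σ _ (λ f → IsMODF A f × weight f ≡ k) × (∀ f → IsMODF A f → k ≤ weight f)

ceil/4 : ℕ → ℕ
ceil/4 m = (m ℕ.+ 3) / 4

module Submission where

-- In a transitive tournament T on n vertices the out-degree `rank v` is injective
-- with values below n, so it is a bijection onto {0,…,n-1}; hence exactly min(n,m)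
-- vertices have rank below m, and N⁺[v] is the set of vertices of rank ≤ rank v, of size
-- rank v + 1.  A ±1 function is `sign ∘ P` for the set P of its positive vertices; its
-- weight is 2|P| - n, and f(X) ≥ 1 iff P is a strict majority of X.
--   Lower bound: a good vertex v satisfies rank v + 2 ≤ 2|N⁺[v] ∩ P| ≤ 2|P|, so at most
--   min(n, 2|P|-1) vertices are good; n ≤ 2·#good then gives n + 2 ≤ 4|P|, i.e.
--   |P| ≥ p := ⌈(n+2)/4⌉.
--   Upper bound: for P = the p vertices of smallest rank every vertex of rank < 2p-1 is
--   good, and 2·min(n, 2p-1) ≥ n because 4p ≥ n + 2.
-- The file develops, in order: counting over Fin n, counting under relabelling, ±1
-- functions and their sums, the arithmetic of ⌈m/4⌉, ranks in a transitive tournament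
-- together with both bounds, and finally the theorem.

open import Defs
open import Data.Nat using (ℕ; suc; _+_; _≤_)
open import Data.Integer using (+_; -_) renaming (_+_ to _+ℤ_; _*_ to _*ℤ_)

open import Data.Bool using (Bool; true; false; if_then_else_; _∧_; not)
open import Data.Bool.Properties using (T-≡)
open import Data.Nat using (zero; _*_; _∸_; _<_; _<ᵇ_; _⊓_; z≤n; s≤s)
import Data.Nat.Properties as ℕP
open import Data.Nat.DivMod using (_%_; m/n*n≤m; m%n<n; m≡m%n+[m/n]*n)
open import Data.Nat.Tactic.RingSolver using (solve-∀)
open import Data.Fin using (Fin; zero; suc; toℕ; fromℕ<; punchOut)
import Data.Fin.Properties as FinP
open import Data.Fin.Permutation using (Permutation; permutation; _⟨$⟩ʳ_)
open import Data.Integer as ℤ using (ℤ; _⊖_; -[1+_])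
import Data.Integer.Properties as ℤP
import Data.Integer.Tactic.RingSolver as ℤRing
import Algebra.Properties.CommutativeMonoid.Sum as MonoidSum
open import Data.Product using (∃; _,_; proj₁; proj₂; _×_)
open import Data.Sum using (_⊎_; inj₁; inj₂)
open import Data.Empty using (⊥-elim)
open import Function using (_∘_; _⇔_; mk⇔; Equivalence)
open import Function.Definitions using (Injective)
open import Relation.Nullary using (Dec; yes; no; does)
open import Relation.Nullary.Decidable using (dec-true)
open import Relation.Binary.PropositionalEquality

<ᵇ-true : ∀ {m n} → m < n → (m <ᵇ n) ≡ true
<ᵇ-true m<n = Equivalence.to T-≡ (ℕP.<⇒<ᵇ m<n)

<ᵇ-sound : ∀ {m n} → (m <ᵇ n) ≡ true → m < n
<ᵇ-sound {m} {n} e = ℕP.<ᵇ⇒< m n (Equivalence.from T-≡ e)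

<ᵇ-false : ∀ {m n} → n ≤ m → (m <ᵇ n) ≡ false
<ᵇ-false {m} {n} n≤m with m <ᵇ n in e
... | true  = ⊥-elim (ℕP.≤⇒≯ n≤m (<ᵇ-sound e))
... | false = refl

<ᵇ-⊓ : ∀ m x y → ((m <ᵇ x) ∧ (m <ᵇ y)) ≡ (m <ᵇ (x ⊓ y))
<ᵇ-⊓ m       zero    y       = refl
<ᵇ-⊓ zero    (suc x) zero    = refl
<ᵇ-⊓ zero    (suc x) (suc y) = refl
<ᵇ-⊓ (suc m) (suc x) zero    with m <ᵇ x
... | true  = refl
... | false = refl
<ᵇ-⊓ (suc m) (suc x) (suc y) = <ᵇ-⊓ m x y

∧-true-right : ∀ {x y} → (x ∧ y) ≡ true → y ≡ true
∧-true-right {true} e = e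

does-sound : ∀ {a} {A : Set a} (a? : Dec A) → does a? ≡ true → A
does-sound (yes a) _ = a

count-cong : ∀ {n} {p q : Fin n → Bool} → (∀ i → p i ≡ q i) → countFin p ≡ countFin q
count-cong {zero}  _ = refl
count-cong {suc n} p≗q =
  cong₂ _+_ (cong (λ b → if b then 1 else 0) (p≗q zero)) (count-cong (p≗q ∘ suc))

count-mono : ∀ {n} {p q : Fin n → Bool} →
  (∀ i → p i ≡ true → q i ≡ true) → countFin p ≤ countFin q
count-mono {zero} _ = z≤n
count-mono {suc n} {p} {q} p⊆q with p zero in p₀ | q zero in q₀
... | true  | true  = s≤s (count-mono (p⊆q ∘ suc))
... | false | true  = ℕP.m≤n⇒m≤1+n (count-mono (p⊆q ∘ suc))
... | false | false = count-mono (p⊆q ∘ suc)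
... | true  | false with () ← trans (sym q₀) (p⊆q zero p₀)

count-strict : ∀ {n} {p q : Fin n → Bool} → (∀ i → p i ≡ true → q i ≡ true) →
  (w : Fin n) → p w ≡ false → q w ≡ true → countFin p < countFin q
count-strict {suc n} {p} {q} p⊆q zero pw qw rewrite pw | qw = s≤s (count-mono (p⊆q ∘ suc))
count-strict {suc n} {p} {q} p⊆q (suc w) pw qw with p zero in p₀ | q zero in q₀
... | true  | true  = s≤s (count-strict (p⊆q ∘ suc) w pw qw)
... | false | true  = ℕP.m≤n⇒m≤1+n (count-strict (p⊆q ∘ suc) w pw qw)
... | false | false = count-strict (p⊆q ∘ suc) w pw qw
... | true  | false with () ← trans (sym q₀) (p⊆q zero p₀)

count-split : ∀ {n} (X P : Fin n → Bool) →
  countFin X ≡ countFin (λ i → X i ∧ P i) + countFin (λ i → X i ∧ not (P i))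
count-split {zero}  X P = refl
count-split {suc n} X P with X zero | P zero
... | false | _     = count-split (X ∘ suc) (P ∘ suc)
... | true  | true  = cong suc (count-split (X ∘ suc) (P ∘ suc))
... | true  | false = trans (cong suc (count-split (X ∘ suc) (P ∘ suc))) (sym (ℕP.+-suc _ _))

count-all : ∀ n → countFin {n} (λ _ → true) ≡ n
count-all zero    = refl
count-all (suc n) = cong suc (count-all n)

count-none : ∀ n → countFin {n} (λ _ → false) ≡ 0
count-none zero    = refl
count-none (suc n) = count-none n

count-prefix : ∀ n m → countFin {n} (λ k → toℕ k <ᵇ m) ≡ n ⊓ m
count-prefix zero    m       = refl
count-prefix (suc n) zero    = count-none n
count-prefix (suc n) (suc m) = cong suc (count-prefix n m)

-- Counting under relabelling.  An injection Fin n → Fin n is onto (otherwise it would inject Fin n into Fin (n - 1)).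
injective⇒surjective : ∀ {n} (σ : Fin n → Fin n) → Injective _≡_ _≡_ σ → ∀ k → ∃ λ v → σ v ≡ k
injective⇒surjective {suc m} σ σ-inj k with FinP.any? (λ v → σ v FinP.≟ k)
... | yes hit = hit
... | no miss = ⊥-elim (ℕP.<-irrefl refl (FinP.injective⇒≤ {f = squeeze} squeeze-inj))
  where
  avoids : ∀ v → k ≢ σ v
  avoids v k≡σv = miss (v , sym k≡σv)
  squeeze : Fin (suc m) → Fin m
  squeeze v = punchOut (avoids v)
  squeeze-inj : Injective _≡_ _≡_ squeeze
  squeeze-inj {x} {y} e = σ-inj (FinP.punchOut-injective (avoids x) (avoids y) e)

-- countFin is the monoid sum of the indicator, so it can use `sum-permute`.
count-as-sum : ∀ {n} (h : Fin n → Bool) →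
  countFin h ≡ MonoidSum.sum ℕP.+-0-commutativeMonoid (λ i → if h i then 1 else 0)
count-as-sum {zero}  h = refl
count-as-sum {suc n} h = cong (λ c → (if h zero then 1 else 0) + c) (count-as-sum (h ∘ suc))

count-∘-injective : ∀ {n} (σ : Fin n → Fin n) → Injective _≡_ _≡_ σ → (h : Fin n → Bool) →
  countFin (h ∘ σ) ≡ countFin h
count-∘-injective {n} σ σ-inj h = begin
  countFin (h ∘ σ)                          ≡⟨ count-as-sum (h ∘ σ) ⟩
  sum (λ i → indicator (π ⟨$⟩ʳ i))           ≡⟨ sym (MonoidSum.sum-permute ℕP.+-0-commutativeMonoid indicator π) ⟩
  sum indicator                             ≡⟨ sym (count-as-sum h) ⟩
  countFin h                                ∎
  where
  open ≡-Reasoning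
  sum = MonoidSum.sum ℕP.+-0-commutativeMonoid
  indicator : Fin n → ℕ
  indicator i = if h i then 1 else 0
  σ⁻¹ : Fin n → Fin n
  σ⁻¹ k = proj₁ (injective⇒surjective σ σ-inj k)
  π : Permutation n n
  π = permutation σ σ⁻¹ (λ k → proj₂ (injective⇒surjective σ σ-inj k))
                        (λ x → σ-inj (proj₂ (injective⇒surjective σ σ-inj (σ x))))

-- An injective labelling of Fin n by numbers below n uses every label once,
-- so exactly min(n, m) labels are below m.
count-labels-below : ∀ {n} (r : Fin n → ℕ) → Injective _≡_ _≡_ r → (∀ v → r v < n) →
  ∀ m → countFin (λ v → r v <ᵇ m) ≡ n ⊓ m
count-labels-below {n} r r-inj r<n m = begin
  countFin (λ v → r v <ᵇ m)           ≡⟨ count-cong (λ v → cong (_<ᵇ m) (sym (FinP.toℕ-fromℕ< (r<n v)))) ⟩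
  countFin (λ v → toℕ (ρ v) <ᵇ m)     ≡⟨ count-∘-injective ρ ρ-inj (λ k → toℕ k <ᵇ m) ⟩
  countFin {n} (λ k → toℕ k <ᵇ m)     ≡⟨ count-prefix n m ⟩
  n ⊓ m                               ∎
  where
  open ≡-Reasoning
  ρ : Fin n → Fin n
  ρ v = fromℕ< (r<n v)
  ρ-inj : Injective _≡_ _≡_ ρ
  ρ-inj {x} {y} e = r-inj (begin
    r x         ≡⟨ sym (FinP.toℕ-fromℕ< (r<n x)) ⟩
    toℕ (ρ x)   ≡⟨ cong toℕ e ⟩
    toℕ (ρ y)   ≡⟨ FinP.toℕ-fromℕ< (r<n y) ⟩
    r y         ∎)

sign : Bool → ℤ
sign b = if b then + 1 else - + 1

positive : ∀ {n} → SignFun n → Fin n → Bool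
positive f v = does (f v ℤP.≟ + 1)

sign-positive : ∀ {n} {f : SignFun n} → IsSign f → ∀ v → f v ≡ sign (positive f v)
sign-positive {f = f} f-sign v with f v ℤP.≟ + 1 | f-sign v
... | yes f≡1 | _          = f≡1
... | no f≢1  | inj₁ f≡1   = ⊥-elim (f≢1 f≡1)
... | no _    | inj₂ f≡-1  = f≡-1

sign-IsSign : ∀ {n} (P : Fin n → Bool) → IsSign (sign ∘ P)
sign-IsSign P v with P v
... | true  = inj₁ refl
... | false = inj₂ refl

fOn-sign : ∀ {n} (P X : Fin n → Bool) →
  fOn (sign ∘ P) X ≡ countFin (λ v → X v ∧ P v) ⊖ countFin (λ v → X v ∧ not (P v))
fOn-sign {zero}  P X = refl
fOn-sign {suc n} P X with X zero | P zero | fOn-sign (P ∘ suc) (X ∘ suc)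
... | false | _     | rest = trans (ℤP.+-identityˡ _) rest
... | true  | true  | rest = trans (cong (+ 1 +ℤ_) rest) (ℤP.distribʳ-⊖-+-pos 1 a b)
  where a = countFin (λ v → X (suc v) ∧ P (suc v))
        b = countFin (λ v → X (suc v) ∧ not (P (suc v)))
... | true  | false | rest = trans (cong (-[1+ 0 ] +ℤ_) rest) (ℤP.distribʳ-⊖-+-neg 0 a b)
  where a = countFin (λ v → X (suc v) ∧ P (suc v))
        b = countFin (λ v → X (suc v) ∧ not (P (suc v)))

⊖-positive : ∀ a b → + 1 ℤ.≤ a ⊖ b → b < a
⊖-positive zero    zero    (ℤ.+≤+ ())
⊖-positive zero    (suc b) ()
⊖-positive (suc a) zero    _ = s≤s z≤n
⊖-positive (suc a) (suc b) h =
  s≤s (⊖-positive a b (subst (+ 1 ℤ.≤_) (ℤP.[1+m]⊖[1+n]≡m⊖n a b) h))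

⊖-positive⁻ : ∀ a b → b < a → + 1 ℤ.≤ a ⊖ b
⊖-positive⁻ (suc a) zero    _       = ℤ.+≤+ (s≤s z≤n)
⊖-positive⁻ (suc a) (suc b) (s≤s h) =
  subst (+ 1 ℤ.≤_) (sym (ℤP.[1+m]⊖[1+n]≡m⊖n a b)) (⊖-positive⁻ a b h)

strict-majority : ∀ a b → b < a ⇔ suc (a + b) ≤ 2 * a
strict-majority a b = mk⇔
  (λ b<a → subst (suc (a + b) ≤_) (sym twice) (ℕP.+-monoʳ-< a b<a))
  (λ h → ℕP.+-cancelˡ-< a b a (subst (suc (a + b) ≤_) twice h))
  where
  twice : 2 * a ≡ a + a
  twice = cong (λ c → a + c) (ℕP.+-identityʳ a)

sign-majority : ∀ {n} (P X : Fin n → Bool) →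
  (+ 1 ℤ.≤ fOn (sign ∘ P) X) ⇔ (suc (countFin X) ≤ 2 * countFin (λ v → X v ∧ P v))
sign-majority P X = mk⇔
  (λ pos → subst (λ s → suc s ≤ 2 * a) (sym size)
             (Equivalence.to (strict-majority a b) (⊖-positive a b (subst (+ 1 ℤ.≤_) (fOn-sign P X) pos))))
  (λ maj → subst (+ 1 ℤ.≤_) (sym (fOn-sign P X))
             (⊖-positive⁻ a b (Equivalence.from (strict-majority a b) (subst (λ s → suc s ≤ 2 * a) size maj))))
  where
  a = countFin (λ v → X v ∧ P v)
  b = countFin (λ v → X v ∧ not (P v))
  size : countFin X ≡ a + b
  size = count-split X P

weight-sign : ∀ {n} (P : Fin n → Bool) → weight (sign ∘ P) ≡ - (+ n) +ℤ (+ 2) *ℤ (+ countFin P)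
weight-sign {n} P = begin
  weight (sign ∘ P)                           ≡⟨ fOn-sign P (λ _ → true) ⟩
  q ⊖ k                                       ≡⟨ sym (ℤP.[+m]-[+n]≡m⊖n q k) ⟩
  + q ℤ.- + k                                 ≡⟨ difference (+ q) (+ k) ⟩
  - (+ q +ℤ + k) +ℤ (+ 2) *ℤ (+ q)            ≡⟨ cong (λ z → - z +ℤ (+ 2) *ℤ (+ q)) (sym (ℤP.pos-+ q k)) ⟩
  - (+ (q + k)) +ℤ (+ 2) *ℤ (+ q)             ≡⟨ cong (λ z → - (+ z) +ℤ (+ 2) *ℤ (+ q)) total ⟩
  - (+ n) +ℤ (+ 2) *ℤ (+ q)                   ∎
  where
  open ≡-Reasoning
  q = countFin P
  k = countFin (λ v → not (P v))
  total : q + k ≡ n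
  total = trans (sym (count-split (λ _ → true) P)) (count-all n)
  difference : ∀ (x y : ℤ) → x ℤ.- y ≡ - (x +ℤ y) +ℤ (+ 2) *ℤ x
  difference = ℤRing.solve-∀

sumFin-cong : ∀ {n} {f g : Fin n → ℤ} → (∀ v → f v ≡ g v) → sumFin f ≡ sumFin g
sumFin-cong {zero}  _   = refl
sumFin-cong {suc n} f≗g = cong₂ _+ℤ_ (f≗g zero) (sumFin-cong (f≗g ∘ suc))

goodCount-cong : ∀ {n} (A : Digraph n) {f g : SignFun n} → (∀ v → f v ≡ g v) →
  goodCount A f ≡ goodCount A g
goodCount-cong A f≗g = count-cong (λ v →
  cong (λ z → does (+ 1 ℤP.≤? z)) (sumFin-cong (λ w → cong (λ z → if closedOutNbhd A v w then z else + 0) (f≗g w))))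

ceil/4-covers : ∀ m → m ≤ 4 * ceil/4 m
ceil/4-covers m = ℕP.+-cancelˡ-≤ 3 m (4 * ceil/4 m) (begin
  3 + m                        ≡⟨ ℕP.+-comm 3 m ⟩
  m + 3                        ≡⟨ m≡m%n+[m/n]*n (m + 3) 4 ⟩
  (m + 3) % 4 + ceil/4 m * 4   ≤⟨ ℕP.+-mono-≤ (ℕP.≤-pred (m%n<n (m + 3) 4)) (ℕP.≤-reflexive (ℕP.*-comm (ceil/4 m) 4)) ⟩
  3 + 4 * ceil/4 m             ∎)
  where open ℕP.≤-Reasoning

ceil/4-least : ∀ m q → m ≤ 4 * q → ceil/4 m ≤ q
ceil/4-least m q m≤4q = ℕP.≤-pred (ℕP.*-cancelʳ-< 4 (ceil/4 m) (suc q) (begin-strict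
  ceil/4 m * 4    ≤⟨ m/n*n≤m (m + 3) 4 ⟩
  m + 3           ≡⟨ ℕP.+-comm m 3 ⟩
  3 + m           ≤⟨ ℕP.+-monoʳ-≤ 3 m≤4q ⟩
  3 + 4 * q       <⟨ ℕP.n<1+n (3 + 4 * q) ⟩
  4 + 4 * q       ≡⟨ cong (λ c → 4 + c) (ℕP.*-comm 4 q) ⟩
  suc q * 4       ∎))
  where open ℕP.≤-Reasoning

-- For q ≥ 1, 2(2q - 1) + 2 = 4q  (2(k+1) - 1 computes to k + (k + 1)).
window-identity : ∀ k → 2 * (2 * suc k ∸ 1) + 2 ≡ 4 * suc k
window-identity k = odd-identity k
  where
  odd-identity : ∀ k → 2 * (k + suc (k + 0)) + 2 ≡ 4 * suc k
  odd-identity = solve-∀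

window-sufficient : ∀ n q → n + 2 ≤ 4 * q → n ≤ 2 * (2 * q ∸ 1)
window-sufficient n zero    n+2≤0 with () ← ℕP.≤-trans (ℕP.m≤n+m 2 n) n+2≤0
window-sufficient n (suc k) n+2≤4q =
  ℕP.+-cancelʳ-≤ 2 n _ (subst (n + 2 ≤_) (sym (window-identity k)) n+2≤4q)

window-necessary : ∀ n q → 1 ≤ n → n ≤ 2 * (2 * q ∸ 1) → n + 2 ≤ 4 * q
window-necessary n zero    1≤n n≤0 with () ← ℕP.≤-trans 1≤n n≤0
window-necessary n (suc k) _   n≤w =
  subst (n + 2 ≤_) (window-identity k) (ℕP.+-monoˡ-≤ 2 n≤w)

<∸1⇒2+≤ : ∀ {x m} → x < m ∸ 1 → suc (suc x) ≤ m
<∸1⇒2+≤ {m = suc m} x<m = s≤s x<m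

2+m≤2[1+m] : ∀ m → 2 + m ≤ 2 * suc m
2+m≤2[1+m] m = ℕP.≤-trans (ℕP.+-monoʳ-≤ 2 (ℕP.m≤n*m m 2)) (ℕP.≤-reflexive (sym (ℕP.*-suc 2 m)))

ceil/4-bounded : ∀ n → 1 ≤ n → ceil/4 (n + 2) ≤ n
ceil/4-bounded n 1≤n =
  ceil/4-least (n + 2) n (ℕP.+-monoʳ-≤ n (ℕP.≤-trans (ℕP.n≤1+n 2) (ℕP.*-monoʳ-≤ 3 1≤n)))

module TransitiveTournament {n} (T : Digraph n) (tournament : IsTournament T)
                            (transitive : IsTransitive T) where

  irreflexive : ∀ u → T u u ≡ false
  irreflexive = proj₁ tournament

  trichotomous : ∀ u v → u ≢ v → (T u v ≡ true × T v u ≡ false) ⊎ (T u v ≡ false × T v u ≡ true)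
  trichotomous = proj₂ tournament

  rank : Fin n → ℕ
  rank v = countFin (T v)

  -- By transitivity N⁺(v) ⊆ N⁺(u) for an arc uv, and v ∈ N⁺(u) ∖ N⁺(v).
  rank-decreases : ∀ {u v} → T u v ≡ true → rank v < rank u
  rank-decreases {u} {v} uv = count-strict (λ w vw → transitive u v w uv vw) v (irreflexive v) uv

  -- v has no loop, so it misses at least itself.
  rank<n : ∀ v → rank v < n
  rank<n v = subst (rank v <_) (count-all n) (count-strict (λ _ _ → refl) v (irreflexive v) refl)

  -- Distinct vertices are joined by an arc, so their ranks differ.
  rank-injective : Injective _≡_ _≡_ rank
  rank-injective {u} {v} same with u FinP.≟ v
  ... | yes u≡v = u≡v
  ... | no u≢v with trichotomous u v u≢v
  ...   | inj₁ (uv , _) = ⊥-elim (ℕP.<-irrefl (sym same) (rank-decreases uv))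
  ...   | inj₂ (_ , vu) = ⊥-elim (ℕP.<-irrefl same (rank-decreases vu))

  count-rank-below : ∀ m → countFin (λ v → rank v <ᵇ m) ≡ n ⊓ m
  count-rank-below = count-labels-below rank rank-injective rank<n

  closedOutNbhd-by-rank : ∀ v w → closedOutNbhd T v w ≡ (rank w <ᵇ suc (rank v))
  closedOutNbhd-by-rank v w with v FinP.≟ w
  ... | yes refl = sym (<ᵇ-true (ℕP.n<1+n (rank v)))
  ... | no v≢w with trichotomous v w v≢w
  ...   | inj₁ (vw , _)  = trans vw (sym (<ᵇ-true (ℕP.m<n⇒m<1+n (rank-decreases vw))))
  ...   | inj₂ (vw , wv) = trans vw (sym (<ᵇ-false (rank-decreases wv)))

  closedOutNbhd-size : ∀ v → countFin (closedOutNbhd T v) ≡ suc (rank v)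
  closedOutNbhd-size v = begin
    countFin (closedOutNbhd T v)               ≡⟨ count-cong (closedOutNbhd-by-rank v) ⟩
    countFin (λ w → rank w <ᵇ suc (rank v))    ≡⟨ count-rank-below (suc (rank v)) ⟩
    n ⊓ suc (rank v)                           ≡⟨ ℕP.m≥n⇒m⊓n≡n (rank<n v) ⟩
    suc (rank v)                               ∎
    where open ≡-Reasoning

  isGood : SignFun n → Fin n → Bool
  isGood f v = does (+ 1 ℤP.≤? fOn f (closedOutNbhd T v))

  p : ℕ
  p = ceil/4 (n + 2)

  -- Lower bound.  A good vertex v has |N⁺[v]| = rank v + 1 < 2|N⁺[v] ∩ P| ≤ 2|P|,
  -- so its rank is below 2|P| - 1.
  good⇒low-rank : ∀ P v → isGood (sign ∘ P) v ≡ true → (rank v <ᵇ (2 * countFin P ∸ 1)) ≡ true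
  good⇒low-rank P v good = <ᵇ-true (ℕP.∸-monoˡ-≤ 1 (begin
    suc (suc (rank v))                                   ≡⟨ cong suc (sym (closedOutNbhd-size v)) ⟩
    suc (countFin (closedOutNbhd T v))                   ≤⟨ Equivalence.to (sign-majority P (closedOutNbhd T v))
                                                                            (does-sound (+ 1 ℤP.≤? _) good) ⟩
    2 * countFin (λ w → closedOutNbhd T v w ∧ P w)      ≤⟨ ℕP.*-monoʳ-≤ 2 (count-mono (λ w → ∧-true-right {closedOutNbhd T v w})) ⟩
    2 * countFin P                                       ∎))
    where open ℕP.≤-Reasoning

  goodCount-bounded : ∀ P → goodCount T (sign ∘ P) ≤ 2 * countFin P ∸ 1
  goodCount-bounded P = ℕP.≤-trans (count-mono (good⇒low-rank P))
    (subst (_≤ 2 * countFin P ∸ 1) (sym (count-rank-below _)) (ℕP.m⊓n≤n n _))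

  -- A MODF is positive on at least p vertices, so its weight is at least -n + 2p.
  MODF-weight-lower : 1 ≤ n → ∀ f → IsMODF T f → - (+ n) +ℤ (+ 2) *ℤ (+ p) ℤ.≤ weight f
  MODF-weight-lower 1≤n f (f-sign , majority) =
    subst (- (+ n) +ℤ (+ 2) *ℤ (+ p) ℤ.≤_) (sym weight-f) (ℤP.+-monoʳ-≤ (- (+ n)) doubled)
    where
    P = positive f
    f≗signP = sign-positive f-sign
    weight-f : weight f ≡ - (+ n) +ℤ (+ 2) *ℤ (+ countFin P)
    weight-f = trans (sumFin-cong f≗signP) (weight-sign P)
    enough : p ≤ countFin P
    enough = ceil/4-least (n + 2) (countFin P) (window-necessary n (countFin P) 1≤n
      (ℕP.≤-trans (subst (λ g → n ≤ 2 * g) (goodCount-cong T f≗signP) majority)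
                  (ℕP.*-monoʳ-≤ 2 (goodCount-bounded P))))
    doubled : (+ 2) *ℤ (+ p) ℤ.≤ (+ 2) *ℤ (+ countFin P)
    doubled = ℤP.*-monoˡ-≤-nonNeg (+ 2) (ℤ.+≤+ enough)

  -- Upper bound: the p vertices of smallest rank.
  bottom : Fin n → Bool
  bottom v = rank v <ᵇ p

  -- It really has p elements, since p ≤ n.
  bottom-size : 1 ≤ n → countFin bottom ≡ p
  bottom-size 1≤n = trans (count-rank-below p) (ℕP.m≥n⇒m⊓n≡n (ceil/4-bounded n 1≤n))

  bottom-in-nbhd : ∀ v → countFin (λ w → closedOutNbhd T v w ∧ bottom w) ≡ suc (rank v) ⊓ p
  bottom-in-nbhd v = begin
    countFin (λ w → closedOutNbhd T v w ∧ bottom w)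
      ≡⟨ count-cong (λ w → trans (cong (_∧ bottom w) (closedOutNbhd-by-rank v w)) (<ᵇ-⊓ (rank w) (suc (rank v)) p)) ⟩
    countFin (λ w → rank w <ᵇ (suc (rank v) ⊓ p))
      ≡⟨ count-rank-below _ ⟩
    n ⊓ (suc (rank v) ⊓ p)
      ≡⟨ ℕP.m≥n⇒m⊓n≡n (ℕP.≤-trans (ℕP.m⊓n≤m (suc (rank v)) p) (rank<n v)) ⟩
    suc (rank v) ⊓ p ∎
    where open ≡-Reasoning

  low-rank⇒good : ∀ v → (rank v <ᵇ (2 * p ∸ 1)) ≡ true → isGood (sign ∘ bottom) v ≡ true
  low-rank⇒good v low = dec-true (+ 1 ℤP.≤? _)
    (Equivalence.from (sign-majority bottom (closedOutNbhd T v)) (begin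
      suc (countFin (closedOutNbhd T v))               ≡⟨ cong suc (closedOutNbhd-size v) ⟩
      suc (suc (rank v))                               ≤⟨ ℕP.⊓-glb (2+m≤2[1+m] (rank v)) (<∸1⇒2+≤ (<ᵇ-sound low)) ⟩
      (2 * suc (rank v)) ⊓ (2 * p)                     ≡⟨ sym (ℕP.*-distribˡ-⊓ 2 (suc (rank v)) p) ⟩
      2 * (suc (rank v) ⊓ p)                           ≡⟨ cong (2 *_) (sym (bottom-in-nbhd v)) ⟩
      2 * countFin (λ w → closedOutNbhd T v w ∧ bottom w) ∎))
    where open ℕP.≤-Reasoning

  -- At least min(n, 2p - 1) ≥ n/2 vertices are good, so sign ∘ bottom is a MODF ...
  bottom-MODF : IsMODF T (sign ∘ bottom)
  bottom-MODF = sign-IsSign bottom , (begin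
    n                                  ≤⟨ ℕP.⊓-glb (ℕP.m≤m+n n _) (window-sufficient n p (ceil/4-covers (n + 2))) ⟩
    (2 * n) ⊓ (2 * (2 * p ∸ 1))         ≡⟨ sym (ℕP.*-distribˡ-⊓ 2 n _) ⟩
    2 * (n ⊓ (2 * p ∸ 1))               ≡⟨ cong (2 *_) (sym (count-rank-below _)) ⟩
    2 * countFin (λ v → rank v <ᵇ (2 * p ∸ 1)) ≤⟨ ℕP.*-monoʳ-≤ 2 (count-mono low-rank⇒good) ⟩
    2 * goodCount T (sign ∘ bottom)     ∎)
    where open ℕP.≤-Reasoning

  bottom-weight : 1 ≤ n → weight (sign ∘ bottom) ≡ - (+ n) +ℤ (+ 2) *ℤ (+ p)
  bottom-weight 1≤n = trans (weight-sign bottom) (cong (λ q → - (+ n) +ℤ (+ 2) *ℤ (+ q)) (bottom-size 1≤n))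

theorem3p4 : (n : ℕ) → 1 ≤ n → (T : Digraph n) → IsTournament T → IsTransitive T →
    IsMajOutDomNumber T (- (+ n) +ℤ (+ 2) *ℤ (+ ceil/4 (n + 2)))
theorem3p4 n 1≤n T tournament transitive =
  (sign ∘ bottom , bottom-MODF , bottom-weight 1≤n) , MODF-weight-lower 1≤n
  where open TransitiveTournament T tournament transitive
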